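{- Let $D$ be a digraph and $T$ a $(k-1,k-1)$-linked set of size $2k-1$ in $D$. Then the $T$-bramble $\mathcal B_T$ is a bramble of order $k$, and a set $X\subseteq V(D)$ is a hitting set of $\mathcal B_T$ if and only if $X$ is a $(T,k-1)$-balanced separator.
   Context: A $(T,r)$-balanced separator is a set $Z\subseteq V(D)$ such that every strong component of $D\setminus Z$ contains at most $r$ vertices of $T$; $T$ is $(k',r)$-linked if every $(T,r)$-balanced separator has size at least $k'+1$. For $T$ with $|T|=2k-1$, the $T$-bramble is $\mathcal B_T=\{B\subseteq D : B \text{ is an induced, strongly connected subgraph of } D \text{ with } |V(B)\cap T|\ge k\}$. A bramble is a family of strongly connected subgraphs any two of which share a vertex or have edges between them in both directions; a hitting set is a vertex set meeting every member; the order is the minimum size of a hitting set. -}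

module Defs where

open import Level using (Level; _⊔_) renaming (suc to lsuc; zero to lzero)
open import Data.Nat using (ℕ; suc; _≤_; _+_; _*_; _∸_)
open import Data.Fin using (Fin)
open import Data.Fin.Subset using (Subset; _∈_; _∉_; _⊆_; _∩_; ∣_∣)
open import Data.Product using (Σ; ∃; _×_; _,_)
open import Relation.Binary.PropositionalEquality using (_≡_)

record Digraph : Set₁ where
  field
    n   : ℕ
    Arc : Fin n → Fin n → Set

open Digraph public

VSet : Digraph → Set
VSet D = Subset (n D)

data Reach (D : Digraph) (S : VSet D) : Fin (n D) → Fin (n D) → Set where
  here : ∀ {u} → u ∈ S → Reach D S u u
  step : ∀ {u w v} → u ∈ S → Arc D u w → Reach D S w v → Reach D S u v

StronglyConnected : (D : Digraph) → VSet D → Set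
StronglyConnected D S =
  (∃ λ v → v ∈ S) × (∀ u v → u ∈ S → v ∈ S → Reach D S u v)

Compl : (D : Digraph) → VSet D → VSet D
Compl D Z = Data.Fin.Subset.∁ Z

StrongComponent : (D : Digraph) → (Z C : VSet D) → Set
StrongComponent D Z C =
  C ⊆ Compl D Z × StronglyConnected D C ×
  (∀ C' → C ⊆ C' → C' ⊆ Compl D Z → StronglyConnected D C' → C' ⊆ C)

BalancedSeparator : (D : Digraph) → (T : VSet D) → ℕ → VSet D → Set
BalancedSeparator D T r Z =
  ∀ C → StrongComponent D Z C → ∣ C ∩ T ∣ ≤ r

Linked : (D : Digraph) → (T : VSet D) → ℕ → ℕ → Set
Linked D T k' r = ∀ Z → BalancedSeparator D T r Z → suc k' ≤ ∣ Z ∣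

-- A family of (induced) subgraphs, given by a predicate on vertex sets.
Family : Digraph → Set₁
Family D = VSet D → Set

Touch : (D : Digraph) → VSet D → VSet D → Set
Touch D B₁ B₂ =
  (∃ λ v → v ∈ B₁ × v ∈ B₂) Data.Sum.⊎
  ((∃ λ u → ∃ λ v → u ∈ B₁ × v ∈ B₂ × Arc D u v) ×
   (∃ λ u → ∃ λ v → u ∈ B₂ × v ∈ B₁ × Arc D u v))
  where import Data.Sum

IsBramble : (D : Digraph) → Family D → Set
IsBramble D 𝓑 =
  (∀ B → 𝓑 B → StronglyConnected D B) ×
  (∀ B₁ B₂ → 𝓑 B₁ → 𝓑 B₂ → Touch D B₁ B₂)

HittingSet : (D : Digraph) → Family D → VSet D → Set
HittingSet D 𝓑 X = ∀ B → 𝓑 B → ∃ λ v → v ∈ X × v ∈ B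

HasOrder : (D : Digraph) → Family D → ℕ → Set
HasOrder D 𝓑 m =
  (∃ λ X → HittingSet D 𝓑 X × ∣ X ∣ ≡ m) ×
  (∀ X → HittingSet D 𝓑 X → m ≤ ∣ X ∣)

TBramble : (D : Digraph) → VSet D → ℕ → Family D
TBramble D T k B = StronglyConnected D B × k ≤ ∣ B ∩ T ∣

module Submission where

-- The proof has three ingredients, developed in this order.
--  * Counting in finite sets: by inclusion–exclusion, two subsets of T of
--    size at least k must meet, since |T| < 2k (pigeonhole).  Hence any two
--    members of the T-bramble share a vertex, and every k-subset of T is a
--    hitting set.
--  * Strong components: every strongly connected B ⊆ V(D) ∖ Z lies in a strong
--    component of D ∖ Z.  The component of b is the set of vertices mutually
--    reachable with b; as reachability need not be decidable, this is only
--    available under double negation, which suffices because we use it to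
--    refute something.
--  * Hitting sets versus separators (valid for every r with k = r + 1): a strong
--    component with ≥ k vertices of T is itself a member of the T-bramble, and
--    a member of the T-bramble avoiding X sits inside a strong component of
--    D ∖ X with ≥ k vertices of T.
-- Linkedness then says that every hitting set has size ≥ k, and a k-subset of
-- T attains this bound.

open import Defs
open import Data.Nat using (ℕ; _≤_; _+_; _*_; _∸_)
open import Data.Fin.Subset using (∣_∣)
open import Data.Product using (_×_)
open import Relation.Binary.PropositionalEquality using (_≡_)

open import Data.Nat using (zero; suc; z≤n; s≤s; _<_)
open import Data.Nat.Properties
  using (+-suc; +-comm; +-identityʳ; +-monoʳ-≤; +-monoˡ-≤; +-cancelˡ-<; +-cancelʳ-≤;
         ≤-trans; ≤-reflexive; <-≤-trans; _≤?_; ≰⇒>; <⇒≱; module ≤-Reasoning)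
open import Data.Fin using (Fin)
open import Data.Fin.Properties using (any?)
open import Data.Fin.Subset using (Subset; _∈_; _⊆_; _∩_; _∪_; Nonempty; inside; outside)
  renaming (⊥ to ∅)
open import Data.Fin.Subset.Properties
  using (_∈?_; nonempty?; Empty-unique; ∣⊥∣≡0; ∉⊥; s⊆s; p⊆q⇒∣p∣≤∣q∣;
         p∩q⊆p; p∩q⊆q; x∈p∩q⁺; x∈p∩q⁻; x∈p∪q⁻; x∈∁p⇒x∉p; x∉p⇒x∈∁p)
open import Data.Vec using (_∷_; []; tabulate)
open import Data.Vec.Properties using ([]=⇒lookup; lookup⇒[]=; lookup∘tabulate)
open import Data.Product using (∃; _,_; proj₁; proj₂)
open import Data.Sum using (inj₁; [_,_])
open import Data.Empty using (⊥-elim)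
open import Relation.Nullary using (¬_; Dec; yes; no; does; _×-dec_)
open import Relation.Nullary.Decidable using (¬¬-excluded-middle)
open import Relation.Binary.PropositionalEquality using (refl; sym; trans; cong; subst)

∣∪∣+∣∩∣ : ∀ {m} (p q : Subset m) → ∣ p ∪ q ∣ + ∣ p ∩ q ∣ ≡ ∣ p ∣ + ∣ q ∣
∣∪∣+∣∩∣ []            []            = refl
∣∪∣+∣∩∣ (inside  ∷ p) (inside  ∷ q) =
  cong suc (trans (+-suc ∣ p ∪ q ∣ ∣ p ∩ q ∣)
                  (trans (cong suc (∣∪∣+∣∩∣ p q)) (sym (+-suc ∣ p ∣ ∣ q ∣))))
∣∪∣+∣∩∣ (inside  ∷ p) (outside ∷ q) = cong suc (∣∪∣+∣∩∣ p q)
∣∪∣+∣∩∣ (outside ∷ p) (inside  ∷ q) = trans (cong suc (∣∪∣+∣∩∣ p q)) (sym (+-suc ∣ p ∣ ∣ q ∣))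
∣∪∣+∣∩∣ (outside ∷ p) (outside ∷ q) = ∣∪∣+∣∩∣ p q

positive⇒nonempty : ∀ {m} (p : Subset m) → 0 < ∣ p ∣ → Nonempty p
positive⇒nonempty {m} p 0<∣p∣ with nonempty? p
... | yes ne = ne
... | no  empty = ⊥-elim (<⇒≱ 0<∣p∣ (≤-reflexive
                    (trans (cong ∣_∣ (Empty-unique empty)) (∣⊥∣≡0 m))))

pigeonhole : ∀ {m} (p q r : Subset m) → p ⊆ r → q ⊆ r →
             ∣ r ∣ < ∣ p ∣ + ∣ q ∣ → Nonempty (p ∩ q)
pigeonhole p q r p⊆r q⊆r r<p+q = positive⇒nonempty (p ∩ q) (+-cancelˡ-< (∣ r ∣) 0 (∣ p ∩ q ∣) 0<∣p∩q∣)
  where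
    p∪q⊆r : p ∪ q ⊆ r
    p∪q⊆r x∈p∪q = [ p⊆r , q⊆r ] (x∈p∪q⁻ p q x∈p∪q)

    0<∣p∩q∣ : ∣ r ∣ + 0 < ∣ r ∣ + ∣ p ∩ q ∣
    0<∣p∩q∣ = begin-strict
      ∣ r ∣ + 0             ≡⟨ +-identityʳ ∣ r ∣ ⟩
      ∣ r ∣                 <⟨ r<p+q ⟩
      ∣ p ∣ + ∣ q ∣         ≡⟨ sym (∣∪∣+∣∩∣ p q) ⟩
      ∣ p ∪ q ∣ + ∣ p ∩ q ∣ ≤⟨ +-monoˡ-≤ ∣ p ∩ q ∣ (p⊆q⇒∣p∣≤∣q∣ p∪q⊆r) ⟩
      ∣ r ∣ + ∣ p ∩ q ∣     ∎
      where open ≤-Reasoning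

large-subsets-meet : ∀ {m} k (p q r : Subset m) → p ⊆ r → q ⊆ r →
                     ∣ r ∣ < k + k → k ≤ ∣ p ∣ → k ≤ ∣ q ∣ → Nonempty (p ∩ q)
large-subsets-meet k p q r p⊆r q⊆r r<2k k≤p k≤q =
  pigeonhole p q r p⊆r q⊆r (<-≤-trans r<2k (≤-trans (+-monoʳ-≤ k k≤q) (+-monoˡ-≤ ∣ q ∣ k≤p)))

subset-of-size : ∀ {m} j (p : Subset m) → j ≤ ∣ p ∣ → ∃ λ q → q ⊆ p × ∣ q ∣ ≡ j
subset-of-size {m} zero p _ = ∅ , (λ x∈⊥ → ⊥-elim (∉⊥ x∈⊥)) , ∣⊥∣≡0 m
subset-of-size (suc j) (inside ∷ p) (s≤s j≤p) with subset-of-size j p j≤p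
... | q , q⊆p , ∣q∣≡j = inside ∷ q , s⊆s q⊆p , cong suc ∣q∣≡j
subset-of-size (suc j) (outside ∷ p) j≤p with subset-of-size (suc j) p j≤p
... | q , q⊆p , ∣q∣≡j = outside ∷ q , s⊆s q⊆p , ∣q∣≡j

¬¬-decidable : ∀ m (P : Fin m → Set) → ¬ ¬ (∀ i → Dec (P i))
¬¬-decidable zero    P k = k (λ ())
¬¬-decidable (suc m) P k =
  ¬¬-excluded-middle λ dec-zero →
  ¬¬-decidable m (λ i → P (Fin.suc i)) λ dec-suc →
  k λ { Fin.zero → dec-zero ; (Fin.suc i) → dec-suc i }

module Walks (D : Digraph) where

  walk-source : ∀ {S u v} → Reach D S u v → u ∈ S
  walk-source (here u∈S)     = u∈S
  walk-source (step u∈S _ _) = u∈S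

  walk-target : ∀ {S u v} → Reach D S u v → v ∈ S
  walk-target (here v∈S)   = v∈S
  walk-target (step _ _ w) = walk-target w

  walk-mono : ∀ {S S' u v} → S ⊆ S' → Reach D S u v → Reach D S' u v
  walk-mono S⊆S' (here u∈S)     = here (S⊆S' u∈S)
  walk-mono S⊆S' (step u∈S a w) = step (S⊆S' u∈S) a (walk-mono S⊆S' w)

  _++ʷ_ : ∀ {S u v w} → Reach D S u v → Reach D S v w → Reach D S u w
  here _       ++ʷ w' = w'
  step u∈S a w ++ʷ w' = step u∈S a (w ++ʷ w')

  module ComponentOf (Z : VSet D) (b : Fin (n D)) (b∉Z : b ∈ Compl D Z)
      (dec : ∀ v → Dec (Reach D (Compl D Z) b v × Reach D (Compl D Z) v b)) where

    S : VSet D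
    S = Compl D Z

    Mutual : Fin (n D) → Set
    Mutual v = Reach D S b v × Reach D S v b

    C : VSet D
    C = tabulate (λ v → does (dec v))

    mutual⇒∈C : ∀ {v} → Mutual v → v ∈ C
    mutual⇒∈C {v} m with dec v in eq
    ... | yes _ = lookup⇒[]= v C (trans (lookup∘tabulate _ v) (cong does eq))
    ... | no ¬m = ⊥-elim (¬m m)

    ∈C⇒mutual : ∀ {v} → v ∈ C → Mutual v
    ∈C⇒mutual {v} v∈C with dec v | trans (sym (lookup∘tabulate (λ u → does (dec u)) v)) ([]=⇒lookup v∈C)
    ... | yes m | _  = m
    ... | no  _ | ()

    b∈C : b ∈ C
    b∈C = mutual⇒∈C (here b∉Z , here b∉Z)

    walk-in-C : ∀ {u v} → Reach D S u v → Reach D S b u → Reach D S v b → Reach D C u v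
    walk-in-C (here _) bu vb = here (mutual⇒∈C (bu , vb))
    walk-in-C (step u∈S a w) bu vb =
      step (mutual⇒∈C (bu , step u∈S a w ++ʷ vb)) a
           (walk-in-C w (bu ++ʷ step u∈S a (here (walk-source w))) vb)

    C-strongly-connected : StronglyConnected D C
    C-strongly-connected = (b , b∈C) , λ u v u∈C v∈C →
      let (bu , ub) = ∈C⇒mutual u∈C
          (bv , vb) = ∈C⇒mutual v∈C
      in walk-in-C (ub ++ʷ bv) bu vb

    ⊆C : ∀ B → b ∈ B → B ⊆ S → StronglyConnected D B → B ⊆ C
    ⊆C B b∈B B⊆S (_ , scB) v∈B =
      mutual⇒∈C (walk-mono B⊆S (scB _ _ b∈B v∈B) , walk-mono B⊆S (scB _ _ v∈B b∈B))

    C-component : StrongComponent D Z C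
    C-component =
      (λ v∈C → walk-target (proj₁ (∈C⇒mutual v∈C))) ,
      C-strongly-connected ,
      λ C' C⊆C' C'⊆S scC' → ⊆C C' (C⊆C' b∈C) C'⊆S scC'

  -- Every strongly connected subgraph of D ∖ Z lies in a strong component
  -- (classically; the component need not be decidable).
  component-containing : ∀ Z B → B ⊆ Compl D Z → StronglyConnected D B →
                         ¬ ¬ (∃ λ C → StrongComponent D Z C × B ⊆ C)
  component-containing Z B B⊆S scB@((b , b∈B) , _) k =
    ¬¬-decidable (n D) _ λ dec →
      let open ComponentOf Z b (B⊆S b∈B) dec
      in k (C , C-component , ⊆C B b∈B B⊆S scB)

module TBrambleFacts (D : Digraph) (T : VSet D) where
  open Walks D

  members-meet : ∀ k → ∣ T ∣ < k + k → ∀ B₁ B₂ →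
                 TBramble D T k B₁ → TBramble D T k B₂ → ∃ λ v → v ∈ B₁ × v ∈ B₂
  members-meet k T<2k B₁ B₂ (_ , k≤B₁) (_ , k≤B₂)
    with large-subsets-meet k (B₁ ∩ T) (B₂ ∩ T) T (p∩q⊆q B₁ T) (p∩q⊆q B₂ T) T<2k k≤B₁ k≤B₂
  ... | v , v∈both =
    let (v∈B₁T , v∈B₂T) = x∈p∩q⁻ (B₁ ∩ T) (B₂ ∩ T) v∈both
    in v , proj₁ (x∈p∩q⁻ B₁ T v∈B₁T) , proj₁ (x∈p∩q⁻ B₂ T v∈B₂T)

  is-bramble : ∀ k → ∣ T ∣ < k + k → IsBramble D (TBramble D T k)
  is-bramble k T<2k = (λ _ → proj₁) , λ B₁ B₂ m₁ m₂ → inj₁ (members-meet k T<2k B₁ B₂ m₁ m₂)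

  large-subset-hits : ∀ k → ∣ T ∣ < k + k → ∀ Y → Y ⊆ T → k ≤ ∣ Y ∣ →
                      HittingSet D (TBramble D T k) Y
  large-subset-hits k T<2k Y Y⊆T k≤Y B (_ , k≤B)
    with large-subsets-meet k (B ∩ T) Y T (p∩q⊆q B T) Y⊆T T<2k k≤B k≤Y
  ... | v , v∈both =
    let (v∈BT , v∈Y) = x∈p∩q⁻ (B ∩ T) Y v∈both
    in v , v∈Y , proj₁ (x∈p∩q⁻ B T v∈BT)

  -- A hitting set of the T-bramble (threshold r+1) is a (T,r)-balanced
  -- separator: a component with more than r vertices of T is a member.
  hitting⇒balanced : ∀ r X → HittingSet D (TBramble D T (suc r)) X → BalancedSeparator D T r X
  hitting⇒balanced r X hits C (C⊆S , scC , _) with ∣ C ∩ T ∣ ≤? r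
  ... | yes small = small
  ... | no  large with hits C (scC , ≰⇒> large)
  ...   | v , v∈X , v∈C = ⊥-elim (x∈∁p⇒x∉p (C⊆S v∈C) v∈X)

  -- A (T,r)-balanced separator hits the T-bramble (threshold r+1): a member
  -- avoiding X would lie in a component of D ∖ X with more than r vertices of T.
  balanced⇒hitting : ∀ r X → BalancedSeparator D T r X → HittingSet D (TBramble D T (suc r)) X
  balanced⇒hitting r X balanced B (scB , large)
    with any? (λ v → (v ∈? X) ×-dec (v ∈? B))
  ... | yes hit = hit
  ... | no  miss = ⊥-elim (component-containing X B B⊆S scB λ (C , isC , B⊆C) →
                     <⇒≱ (≤-trans large (p⊆q⇒∣p∣≤∣q∣ (B∩T⊆C∩T B⊆C))) (balanced C isC))
    where
      B⊆S : B ⊆ Compl D X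
      B⊆S {v} v∈B with v ∈? X
      ... | yes v∈X = ⊥-elim (miss (v , v∈X , v∈B))
      ... | no  v∉X = x∉p⇒x∈∁p v∉X

      B∩T⊆C∩T : ∀ {C} → B ⊆ C → B ∩ T ⊆ C ∩ T
      B∩T⊆C∩T B⊆C v∈BT = x∈p∩q⁺ (B⊆C (p∩q⊆p B T v∈BT) , p∩q⊆q B T v∈BT)

size-bounds : ∀ t k → t + 1 ≡ 2 * suc k → t < suc k + suc k × suc k ≤ t
size-bounds t k t+1≡2k = ≤-reflexive t<2k , +-cancelʳ-≤ 1 (suc k) t k+1≤t+1
  where
    t<2k : suc t ≡ suc k + suc k
    t<2k = trans (+-comm 1 t) (trans t+1≡2k (cong (suc k +_) (+-identityʳ (suc k))))

    k+1≤t+1 : suc k + 1 ≤ t + 1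
    k+1≤t+1 = subst (suc k + 1 ≤_) (sym (trans (+-comm t 1) t<2k)) (+-monoʳ-≤ (suc k) (s≤s z≤n))

mainTheorem9 : (D : Digraph) (k : ℕ) (T : VSet D) →
    1 ≤ k → ∣ T ∣ + 1 ≡ 2 * k →
    Linked D T (k ∸ 1) (k ∸ 1) →
    IsBramble D (TBramble D T k) × HasOrder D (TBramble D T k) k ×
    (∀ X → (HittingSet D (TBramble D T k) X → BalancedSeparator D T (k ∸ 1) X) ×
    (BalancedSeparator D T (k ∸ 1) X → HittingSet D (TBramble D T k) X))
mainTheorem9 D (suc r) T (s≤s z≤n) ∣T∣≡2k-1 linked =
  is-bramble k T<2k ,
  (small-hitting-set , λ X hits → linked X (hitting⇒balanced r X hits)) ,
  λ X → hitting⇒balanced r X , balanced⇒hitting r X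
  where
    open TBrambleFacts D T
    k : ℕ
    k = suc r

    T<2k : ∣ T ∣ < k + k
    T<2k = proj₁ (size-bounds ∣ T ∣ r ∣T∣≡2k-1)

    small-hitting-set : ∃ λ Y → HittingSet D (TBramble D T k) Y × ∣ Y ∣ ≡ k
    small-hitting-set with subset-of-size k T (proj₂ (size-bounds ∣ T ∣ r ∣T∣≡2k-1))
    ... | Y , Y⊆T , ∣Y∣≡k = Y , large-subset-hits k T<2k Y Y⊆T (≤-reflexive (sym ∣Y∣≡k)) , ∣Y∣≡k
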